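{- Let $r,p,q,n,k$ be positive integers with $p\mid r$, $q\mid r$, $pq\mid rn$, and $G^*=G(r,q,p,n)$. The map $$\Phi(g_1,\ldots,g_k;\lambda^{(1)},\ldots,\lambda^{(k)})=\big(\lambda^{(i)}_{\tau_i(j)}\big)_{i\in[k],\,j\in[n]},$$ where $\tau_1=\mathrm{id}$, $\tau_i=\sigma_1\cdots\sigma_{i-1}$, $\sigma_l=|g_l|$, and permutations are composed from left to right ($(\sigma_1\sigma_2)(j)=\sigma_2(\sigma_1(j))$), is a bijection from the set of $2k$-tuples $(g_1,\ldots,g_k;\lambda^{(1)},\ldots,\lambda^{(k)})$ with $g_1,\ldots,g_k\in G^*$, $g_1\cdots g_k=1$, and $\lambda^{(i)}$ a $g_i$-compatible partition for every $i$, onto the set $\mathcal B_k(r,p,q,n)$.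
   Context: Notation: $\zeta_m=e^{2\pi i/m}$. $G(r,n)$ is the group of $n\times n$ monomial matrices whose nonzero entries are $r$-th roots of unity; $g=[\sigma;c_1,\ldots,c_n]$ means row $i$ has nonzero entry $\zeta_r^{c_i}$ in column $\sigma(i)$, and $|g|=\sigma$. For $a\mid r$, $G(r,a,n)=\{[\sigma;c]:\sum c_i\equiv0\bmod a\}$; for $b\mid r$, $ab\mid rn$, $G(r,a,b,n)=G(r,a,n)/\langle\zeta_bI\rangle$, elements written $[\sigma;c]$ via representatives. For $g=[\sigma;c]\in G(r,a,b,n)$: $[c]_s$ is the least nonnegative residue mod $s$; $\mathrm{HDes}(g)=\{i\in[n-1]:c_i\equiv c_{i+1}\ (\bmod r),\ \sigma(i)>\sigma(i+1)\}$; $h_i(g)=\#\{j\ge i:j\in\mathrm{HDes}(g)\}$; $k_n(g)=[c_n]_{r/b}$, $k_i(g)=k_{i+1}(g)+[c_i-c_{i+1}]_r$; $\lambda_i(g)=rh_i(g)+k_i(g)$, and $\lambda(g)=(\lambda_1(g),\ldots,\lambda_n(g))$, a partition. A partition $\lambda=(\lambda_1\ge\cdots\ge\lambda_n\ge0)$ with $n$ parts is $g$-compatible (for $g\in G^*$) if $\lambda-\lambda(g)$ is a partition (weakly decreasing, nonnegative) and $g=[|g|;\lambda_1,\ldots,\lambda_n]$. A $k\times n$ matrix $A=(a_{i,j})$ of nonnegative integers is a $k$-partite partition if $a_{i,j}\ge a_{i,j+1}$ whenever $a_{h,j}=a_{h,j+1}$ for all $h<i$. $\mathcal B_k(r,p,q,n)$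 is the set of $k\times n$ $k$-partite partitions all of whose row sums are divisible by $q$ and whose column sums $s_1,\ldots,s_n$ satisfy $s_i\equiv s_j\pmod r$ for all $i,j$ and $ps_i\equiv0\pmod r$ for all $i$. -}

module Defs where

open import Data.Nat using (ℕ; zero; suc; _+_; _*_; _∸_; _≤_; _<_; _<?_; _≟_)
open import Data.Nat.Divisibility using (_∣_)
open import Data.Nat.DivMod using (_/_; _%_)
open import Data.Fin using (Fin; toℕ) renaming (zero to fzero; suc to fsuc)
open import Data.Fin.Permutation using (Permutation′; _⟨$⟩ʳ_; _∘ₚ_) renaming (id to idₚ)
open import Data.List using (List; []; _∷_; drop; tabulate)
open import Data.Nat.ListAction using (sum)
open import Data.Bool using (if_then_else_; _∧_)
open import Data.Product using (Σ; _×_; _,_; ∃)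
open import Relation.Nullary.Decidable using (⌊_⌋)
open import Relation.Binary.PropositionalEquality using (_≡_)

-- Arithmetic helpers (the divisors are positive in the theorem; the
-- zero-divisor clauses are never used there).

mod0 : ℕ → ℕ → ℕ
mod0 m zero    = m
mod0 m (suc s) = m % suc s

div0 : ℕ → ℕ → ℕ
div0 m zero    = 0
div0 m (suc s) = m / suc s

_≡[mod_]_ : ℕ → ℕ → ℕ → Set
a ≡[mod s ] b = mod0 a s ≡ mod0 b s

-- [a - b]_r  (least nonnegative residue of the integer a - b modulo r)
diffMod : ℕ → ℕ → ℕ → ℕ
diffMod r a b = mod0 (a + (r ∸ mod0 b r)) r

Σ[_] : (n : ℕ) → (Fin n → ℕ) → ℕ
Σ[ n ] f = sum (tabulate {n = n} f)

-- Elements of G(r,n), written [σ; c]: row i has entry ζ_r^{c_i} in column σ(i).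
-- Colours are natural numbers read modulo r.

record Mon (n : ℕ) : Set where
  constructor [_⨾_]
  field
    perm : Permutation′ n
    col  : Fin n → ℕ
open Mon public

∣_∣ₘ : ∀ {n} → Mon n → Permutation′ n
∣ g ∣ₘ = perm g

-- matrix product g·h ; |g h| = |g| |h| composed left to right
_·ₘ_ : ∀ {n} → Mon n → Mon n → Mon n
g ·ₘ h = [ perm g ∘ₚ perm h ⨾ (λ i → col g i + col h (perm g ⟨$⟩ʳ i)) ]

oneₘ : ∀ {n} → Mon n
oneₘ = [ idₚ ⨾ (λ _ → 0) ]

InG : (r a n : ℕ) → Mon n → Set
InG r a n g = a ∣ Σ[ n ] (col g)

-- equality in G(r,a,b,n) = G(r,a,n)/⟨ζ_b I⟩ (ζ_b I = [id; r/b,…,r/b]):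
-- same underlying permutation, colours congruent mod r up to a common
-- multiple of r/b.
EqG : (r b : ℕ) → ∀ {n} → Mon n → Mon n → Set
EqG r b {n} g h =
  (∀ j → perm g ⟨$⟩ʳ j ≡ perm h ⟨$⟩ʳ j) ×
  ∃ λ (m : ℕ) → ∀ i → col g i ≡[mod r ] (col h i + m * div0 r b)

prodₘ : ∀ {n} (k : ℕ) → (Fin k → Mon n) → Mon n
prodₘ zero    g = oneₘ
prodₘ (suc k) g = g fzero ·ₘ prodₘ k (λ i → g (fsuc i))

τ : ∀ {n k} → (Fin k → Mon n) → Fin k → Permutation′ n
τ g fzero    = idₚ
τ g (fsuc i) = perm (g fzero) ∘ₚ τ (λ j → g (fsuc j)) i

-- λ(g).  For the suffix (σ(i),c_i),…,(σ(n),c_n) compute (h_i(g), k_i(g)).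

hk : (r b : ℕ) → List (ℕ × ℕ) → ℕ × ℕ
hk r b []                = 0 , 0
hk r b ((s , c) ∷ [])    = 0 , mod0 c (div0 r b)
hk r b ((s , c) ∷ ((s' , c') ∷ xs)) with hk r b ((s' , c') ∷ xs)
... | h , k =
  (h + (if ⌊ mod0 c r ≟ mod0 c' r ⌋ ∧ ⌊ s' <? s ⌋ then 1 else 0))
  , (k + diffMod r c c')

lamG : (r b : ℕ) → ∀ {n} → Mon n → Fin n → ℕ
lamG r b {n} g i with hk r b (drop (toℕ i) (tabulate {n = n} (λ j → toℕ (perm g ⟨$⟩ʳ j) , col g j)))
... | h , k = r * h + k

IsPartition : ∀ {n} → (Fin n → ℕ) → Set
IsPartition {n} μ = ∀ (i j : Fin n) → toℕ i ≤ toℕ j → μ j ≤ μ i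

Compatible : (r b : ℕ) → ∀ {n} → Mon n → (Fin n → ℕ) → Set
Compatible r b {n} g μ =
  IsPartition μ ×
  (∀ i → lamG r b g i ≤ μ i) ×
  IsPartition (λ i → μ i ∸ lamG r b g i) ×
  EqG r b g [ perm g ⨾ μ ]

Matrix : ℕ → ℕ → Set
Matrix k n = Fin k → Fin n → ℕ

IsKPartite : ∀ {k n} → Matrix k n → Set
IsKPartite {k} {n} A =
  ∀ (i : Fin k) (j j' : Fin n) → toℕ j' ≡ suc (toℕ j) →
  (∀ (h : Fin k) → toℕ h < toℕ i → A h j ≡ A h j') →
  A i j' ≤ A i j

InB : (r p q : ℕ) → ∀ {k n} → Matrix k n → Set
InB r p q {k} {n} A =
  IsKPartite A ×
  (∀ i → q ∣ Σ[ n ] (A i)) ×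
  (∀ j j' → Σ[ k ] (λ i → A i j) ≡[mod r ] Σ[ k ] (λ i → A i j')) ×
  (∀ j → r ∣ p * Σ[ k ] (λ i → A i j))

InDom : (r p q n k : ℕ) → (Fin k → Mon n) → Matrix k n → Set
InDom r p q n k g lam =
  (∀ i → InG r q n (g i)) ×
  EqG r p (prodₘ k g) oneₘ ×
  (∀ i → Compatible r p (g i) (lam i))

Φ : ∀ {n k} → (Fin k → Mon n) → Matrix k n → Matrix k n
Φ g lam i j = lam i (τ g i ⟨$⟩ʳ j)

-- A partition μ is compatible with g = [σ; c] exactly when c agrees with μ modulo r up to a
-- common multiple of r/p and μ is decreasing with its ties listed by σ in increasing order: the
-- increments λ_x(g) − λ_{x+1}(g) = r·[x ∈ HDes(g)] + [c_x − c_{x+1}]_r then fit into the gaps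
-- μ_x − μ_{x+1}. Consequently τ_i is the permutation sorting the columns of A = Φ(g; λ)
-- lexicographically by rows i, …, k (larger entries first, then by column index), since
-- g_1⋯g_k = 1 forces τ_{k+1} = id. This makes A k-partite and recovers every τ_i, hence every
-- g_i and λ^(i), from A. Conversely, for A ∈ 𝓑_k let τ_i sort its columns in this way and put
-- g_i = [τ_i⁻¹ τ_{i+1}; λ^(i)] with λ^(i) the i-th row of A read through τ_i⁻¹. Row sums
-- govern g_i ∈ G(r,q,n) (as q ∣ n·r/p) and column sums govern g_1⋯g_k = 1 in G(r,q,p,n).

module Submission where

open import Defs
open import Data.Nat using (ℕ; zero; suc; _+_; _*_; _∸_; _≤_; _<_; z≤n; s≤s; s≤s⁻¹; _≟_; _<?_)
open import Data.Nat.Properties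
open import Data.Nat.DivMod using (_/_; _%_; m≡m%n+[m/n]*n; [m+kn]%n≡m%n; [m+n]%n≡m%n; m%n<n; m%n≤m; m*n%n≡0; m*[n/m]≡n)
open import Data.Nat.Divisibility using (_∣_; divides; _∣0; ∣m+n∣m⇒∣n; ∣m∣n⇒∣m+n; n∣m*n; ∣m⇒∣m*n; *-cancelˡ-∣)
open import Data.Nat.Solver using (module +-*-Solver)
open import Data.Fin as Fin using (Fin; toℕ; fromℕ; fromℕ<; inject₁) renaming (zero to fzero; suc to fsuc; _<_ to _<ᶠ_)
open import Data.Fin.Properties
  using (toℕ-injective; toℕ-fromℕ<; toℕ-fromℕ; toℕ-inject₁; punchOut-injective; injective⇒≤; any?)
  renaming (<-cmp to <ᶠ-cmp; <-trans to <ᶠ-trans)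
open import Data.Fin.Induction using (<-weakInduction; >-weakInduction)
open import Data.Fin.Permutation
  using (Permutation′; _⟨$⟩ʳ_; _⟨$⟩ˡ_; _∘ₚ_; _≈_; inverseˡ; inverseʳ; flip; permutation) renaming (id to idₚ)
open import Data.Fin.Subset using (Subset; inside; outside; _∈_; ⊤; ∣_∣)
open import Data.Fin.Subset.Properties using (p⊂q⇒∣p∣<∣q∣; ∈⊤; ⊆⊤; ∣⊤∣≡n)
open import Data.Vec using (tabulate)
open import Data.Vec.Properties using (lookup⇒[]=; []=⇒lookup; lookup∘tabulate)
open import Data.List as List using (List; []; _∷_; drop)
open import Data.Bool using (if_then_else_; _∧_)
open import Data.Product using (Σ; _×_; _,_; ∃₂; proj₁; proj₂)
open import Data.Sum using (_⊎_; inj₁; inj₂; [_,_]′)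
open import Function using (_∘_; id)
open import Function.Bundles using (_⇔_; mk⇔; Equivalence)
open import Level using (0ℓ)
open import Relation.Nullary using (¬_; yes; no; does; contradiction)
open import Relation.Nullary.Decidable using (⌊_⌋)
open import Relation.Unary using (Pred; Decidable)
open import Relation.Binary using (Rel; Transitive; Trichotomous; IsStrictTotalOrder; tri<; tri≈; tri>)
open import Relation.Binary.Consequences using (tri⇒irr)
open import Relation.Binary.PropositionalEquality hiding ([_])
open import Algebra.Properties.Semiring.Sum +-*-semiring as ∑ using ()
open import Algebra.Properties.CommutativeSemigroup +-commutativeSemigroup using (xy∙z≈xz∙y; x∙yz≈y∙zx)
open +-*-Solver

private
  variable
    n k : ℕ

-- Congruences

-- a ≡ b (mod r), phrased without subtraction.
infix 4 _≋_[mod_]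
_≋_[mod_] : ℕ → ℕ → ℕ → Set
a ≋ b [mod r ] = ∃₂ λ x y → a + x * r ≡ b + y * r

module _ {r : ℕ} where

  ≋-refl : ∀ {a} → a ≋ a [mod r ]
  ≋-refl = 0 , 0 , refl

  ≋-sym : ∀ {a b} → a ≋ b [mod r ] → b ≋ a [mod r ]
  ≋-sym (x , y , e) = y , x , sym e

  +-cong-≋ : ∀ {a b c d} → a ≋ b [mod r ] → c ≋ d [mod r ] → a + c ≋ b + d [mod r ]
  +-cong-≋ {a} {b} {c} {d} (x , y , e) (u , v , f) = x + u , y + v , (begin
    a + c + (x + u) * r        ≡⟨ shuffle a c x u r ⟩
    (a + x * r) + (c + u * r)  ≡⟨ cong₂ _+_ e f ⟩
    (b + y * r) + (d + v * r)  ≡⟨ sym (shuffle b d y v r) ⟩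
    b + d + (y + v) * r        ∎)
    where
    open ≡-Reasoning
    shuffle : ∀ a c x u r → a + c + (x + u) * r ≡ (a + x * r) + (c + u * r)
    shuffle = solve 5 (λ a c x u r → a :+ c :+ (x :+ u) :* r := (a :+ x :* r) :+ (c :+ u :* r)) refl

  +-cancelʳ-≋ : ∀ {a b c} → a + c ≋ b + c [mod r ] → a ≋ b [mod r ]
  +-cancelʳ-≋ {a} {b} {c} (x , y , e) = x , y , +-cancelʳ-≡ c _ _ (begin
    a + x * r + c  ≡⟨ xy∙z≈xz∙y a (x * r) c ⟩
    a + c + x * r  ≡⟨ e ⟩
    b + c + y * r  ≡⟨ xy∙z≈xz∙y b c (y * r) ⟩
    b + y * r + c  ∎)
    where open ≡-Reasoning

  ≋-trans : ∀ {a b c} → a ≋ b [mod r ] → b ≋ c [mod r ] → a ≋ c [mod r ]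
  ≋-trans {a} {b} {c} ab bc = +-cancelʳ-≋ (subst (λ t → a + b ≋ t [mod r ]) (+-comm b c) (+-cong-≋ ab bc))

  *-congˡ-≋ : ∀ {a b} c → a ≋ b [mod r ] → c * a ≋ c * b [mod r ]
  *-congˡ-≋ {a} {b} c (x , y , e) = c * x , c * y , (begin
    c * a + c * x * r  ≡⟨ distrib c a x r ⟩
    c * (a + x * r)    ≡⟨ cong (c *_) e ⟩
    c * (b + y * r)    ≡⟨ sym (distrib c b y r) ⟩
    c * b + c * y * r  ∎)
    where
    open ≡-Reasoning
    distrib : ∀ c a x r → c * a + c * x * r ≡ c * (a + x * r)
    distrib = solve 4 (λ c a x r → c :* a :+ c :* x :* r := c :* (a :+ x :* r)) refl

  *-multiple-≋ : ∀ t → t * r ≋ 0 [mod r ]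
  *-multiple-≋ t = 0 , t , +-identityʳ _

  ∣-resp-≋ : ∀ {a b} → a ≋ b [mod r ] → r ∣ a → r ∣ b
  ∣-resp-≋ {a} {b} (x , y , e) r∣a = ∣m+n∣m⇒∣n r∣yr+b (n∣m*n y)
    where
    r∣yr+b : r ∣ y * r + b
    r∣yr+b = subst (r ∣_) (trans e (+-comm b (y * r))) (∣m∣n⇒∣m+n r∣a (n∣m*n x))

≋-weaken : ∀ {r s a b} → s ∣ r → a ≋ b [mod r ] → a ≋ b [mod s ]
≋-weaken {s = s} {a} {b} (divides t refl) (x , y , e) = x * t , y * t , (begin
  a + x * t * s    ≡⟨ cong (a +_) (*-assoc x t s) ⟩
  a + x * (t * s)  ≡⟨ e ⟩
  b + y * (t * s)  ≡⟨ cong (b +_) (sym (*-assoc y t s)) ⟩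
  b + y * t * s    ∎)
  where open ≡-Reasoning

%-≡⇒≋ : ∀ {r a b} → 0 < r → mod0 a r ≡ mod0 b r → a ≋ b [mod r ]
%-≡⇒≋ {suc r} {a} {b} _ e = b / suc r , a / suc r , (begin
  a + b / suc r * suc r                                ≡⟨ cong (_+ _) (m≡m%n+[m/n]*n a (suc r)) ⟩
  a % suc r + a / suc r * suc r + b / suc r * suc r    ≡⟨ cong (λ t → t + a / suc r * suc r + b / suc r * suc r) e ⟩
  b % suc r + a / suc r * suc r + b / suc r * suc r    ≡⟨ xy∙z≈xz∙y (b % suc r) _ _ ⟩
  b % suc r + b / suc r * suc r + a / suc r * suc r    ≡⟨ cong (_+ _) (sym (m≡m%n+[m/n]*n b (suc r))) ⟩
  b + a / suc r * suc r                                ∎)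
  where open ≡-Reasoning

≋⇒%-≡ : ∀ {r a b} → 0 < r → a ≋ b [mod r ] → mod0 a r ≡ mod0 b r
≋⇒%-≡ {suc r} {a} {b} _ (x , y , e) = begin
  a % suc r              ≡⟨ sym ([m+kn]%n≡m%n a x (suc r)) ⟩
  (a + x * suc r) % suc r ≡⟨ cong (_% suc r) e ⟩
  (b + y * suc r) % suc r ≡⟨ [m+kn]%n≡m%n b y (suc r) ⟩
  b % suc r              ∎
  where open ≡-Reasoning

mod0≤ : ∀ m s → mod0 m s ≤ m
mod0≤ m zero    = ≤-refl
mod0≤ m (suc s) = m%n≤m m (suc s)

-- Finite sums

Σ≡sum : ∀ n (f : Fin n → ℕ) → Σ[ n ] f ≡ ∑.sum f
Σ≡sum zero    f = refl
Σ≡sum (suc n) f = cong (f fzero +_) (Σ≡sum n (f ∘ fsuc))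

Σ-cong : {f g : Fin n → ℕ} → (∀ i → f i ≡ g i) → Σ[ n ] f ≡ Σ[ n ] g
Σ-cong {zero}  e = refl
Σ-cong {suc n} e = cong₂ _+_ (e fzero) (Σ-cong (e ∘ fsuc))

Σ-permute : (f : Fin n → ℕ) (π : Permutation′ n) → Σ[ n ] (λ x → f (π ⟨$⟩ʳ x)) ≡ Σ[ n ] f
Σ-permute {n} f π = begin
  Σ[ n ] (λ x → f (π ⟨$⟩ʳ x)) ≡⟨ Σ≡sum n _ ⟩
  ∑.sum (λ x → f (π ⟨$⟩ʳ x))  ≡⟨ sym (∑.sum-permute f π) ⟩
  ∑.sum f                     ≡⟨ sym (Σ≡sum n f) ⟩
  Σ[ n ] f                    ∎
  where open ≡-Reasoning

Σ-distrib-+ : (f g : Fin n → ℕ) → Σ[ n ] (λ i → f i + g i) ≡ Σ[ n ] f + Σ[ n ] g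
Σ-distrib-+ {n} f g = begin
  Σ[ n ] (λ i → f i + g i)   ≡⟨ Σ≡sum n _ ⟩
  ∑.sum (λ i → f i + g i)    ≡⟨ ∑.∑-distrib-+ f g ⟩
  ∑.sum f + ∑.sum g          ≡⟨ sym (cong₂ _+_ (Σ≡sum n f) (Σ≡sum n g)) ⟩
  Σ[ n ] f + Σ[ n ] g        ∎
  where open ≡-Reasoning

Σ-distrib-*ʳ : (f : Fin n → ℕ) (c : ℕ) → Σ[ n ] (λ i → f i * c) ≡ Σ[ n ] f * c
Σ-distrib-*ʳ {n} f c = begin
  Σ[ n ] (λ i → f i * c)   ≡⟨ Σ≡sum n _ ⟩
  ∑.sum (λ i → f i * c)    ≡⟨ sym (∑.*-distribʳ-sum c f) ⟩
  ∑.sum f * c              ≡⟨ cong (_* c) (sym (Σ≡sum n f)) ⟩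
  Σ[ n ] f * c             ∎
  where open ≡-Reasoning

Σ-const : ∀ n c → Σ[ n ] (λ _ → c) ≡ n * c
Σ-const zero    c = refl
Σ-const (suc n) c = cong (c +_) (Σ-const n c)

Σ-cong-≋ : ∀ {r} {f g : Fin n → ℕ} → (∀ i → f i ≋ g i [mod r ]) → Σ[ n ] f ≋ Σ[ n ] g [mod r ]
Σ-cong-≋ {zero}  e = ≋-refl
Σ-cong-≋ {suc n} e = +-cong-≋ (e fzero) (Σ-cong-≋ (e ∘ fsuc))

-- Orders on Fin and sorting permutations

toℕ-adjacent : (i : Fin n) → toℕ (fsuc i) ≡ suc (toℕ (inject₁ i))
toℕ-adjacent i = cong suc (sym (toℕ-inject₁ i))

adjacent⇒< : ∀ {x y : Fin n} → toℕ y ≡ suc (toℕ x) → x <ᶠ y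
adjacent⇒< y≡1+x = ≤-reflexive (sym y≡1+x)

chain : ∀ {ℓ} (R : Rel (Fin n) ℓ) → Transitive R →
        (∀ {x y} → toℕ y ≡ suc (toℕ x) → R x y) → ∀ {x y} → x <ᶠ y → R x y
chain {suc n} R R-trans adjacent {x} {y} = <-weakInduction (λ y → x <ᶠ y → R x y) (λ ()) step y
  where
  step : ∀ i → (x <ᶠ inject₁ i → R x (inject₁ i)) → x <ᶠ fsuc i → R x (fsuc i)
  step i ih x<1+i with m≤n⇒m<n∨m≡n (s≤s⁻¹ x<1+i)
  ... | inj₁ x<i = R-trans (ih (subst (toℕ x <_) (sym (toℕ-inject₁ i)) x<i)) (adjacent (toℕ-adjacent i))
  ... | inj₂ x≡i = adjacent (cong suc (sym x≡i))

antitone⇒partition : (μ : Fin n → ℕ) → (∀ {x y} → toℕ y ≡ suc (toℕ x) → μ y ≤ μ x) → IsPartition μ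
antitone⇒partition μ adjacent x y x≤y with m≤n⇒m<n∨m≡n x≤y
... | inj₁ x<y = chain (λ a b → μ b ≤ μ a) (λ ab bc → ≤-trans bc ab) adjacent x<y
... | inj₂ x≡y = ≤-reflexive (cong μ (toℕ-injective (sym x≡y)))

⟨$⟩ʳ-injective : (π : Permutation′ n) {x y : Fin n} → π ⟨$⟩ʳ x ≡ π ⟨$⟩ʳ y → x ≡ y
⟨$⟩ʳ-injective π {x} {y} e = trans (sym (inverseˡ π)) (trans (cong (π ⟨$⟩ˡ_) e) (inverseˡ π))

infix 4 _Sorts_
_Sorts_ : ∀ {ℓ} → Permutation′ n → Rel (Fin n) ℓ → Set ℓ
π Sorts R = ∀ j j' → R j j' ⇔ π ⟨$⟩ʳ j <ᶠ π ⟨$⟩ʳ j'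

increasing⇒inflationary : (f : Fin n → Fin n) → (∀ {x y} → x <ᶠ y → f x <ᶠ f y) → ∀ x → toℕ x ≤ toℕ (f x)
increasing⇒inflationary {suc n} f increasing = <-weakInduction (λ x → toℕ x ≤ toℕ (f x)) z≤n step
  where
  step : ∀ i → toℕ (inject₁ i) ≤ toℕ (f (inject₁ i)) → toℕ (fsuc i) ≤ toℕ (f (fsuc i))
  step i ih = ≤-trans (subst (_≤ suc (toℕ (f (inject₁ i)))) (sym (toℕ-adjacent i)) (s≤s ih))
                      (increasing (adjacent⇒< (toℕ-adjacent i)))

-- Both π' ∘ π⁻¹ and its inverse are increasing, hence inflationary, hence the identity.
sorts-unique : ∀ {ℓ} {R : Rel (Fin n) ℓ} (π π' : Permutation′ n) → π Sorts R → π' Sorts R →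
               ∀ j → π ⟨$⟩ʳ j ≡ π' ⟨$⟩ʳ j
sorts-unique {n} {R = R} π π' π-sorts π'-sorts j = toℕ-injective (≤-antisym πj≤π'j π'j≤πj)
  where
  transport : (ρ ρ' : Permutation′ n) → ρ Sorts R → ρ' Sorts R → ∀ x → toℕ x ≤ toℕ (ρ' ⟨$⟩ʳ (ρ ⟨$⟩ˡ x))
  transport ρ ρ' ρ-sorts ρ'-sorts = increasing⇒inflationary _ λ {x} {y} x<y →
    Equivalence.to (ρ'-sorts _ _) (Equivalence.from (ρ-sorts _ _) (subst₂ _<ᶠ_ (sym (inverseʳ ρ)) (sym (inverseʳ ρ)) x<y))
  πj≤π'j : toℕ (π ⟨$⟩ʳ j) ≤ toℕ (π' ⟨$⟩ʳ j)
  πj≤π'j = subst (λ t → toℕ (π ⟨$⟩ʳ j) ≤ toℕ (π' ⟨$⟩ʳ t)) (inverseˡ π)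
                 (transport π π' π-sorts π'-sorts (π ⟨$⟩ʳ j))
  π'j≤πj : toℕ (π' ⟨$⟩ʳ j) ≤ toℕ (π ⟨$⟩ʳ j)
  π'j≤πj = subst (λ t → toℕ (π' ⟨$⟩ʳ j) ≤ toℕ (π ⟨$⟩ʳ t)) (inverseˡ π')
                 (transport π' π π'-sorts π-sorts (π' ⟨$⟩ʳ j))

injective⇒surjective : (f : Fin n → Fin n) → (∀ {x y} → f x ≡ f y → x ≡ y) → ∀ y → Σ (Fin n) λ x → f x ≡ y
injective⇒surjective {suc n} f f-injective y with any? (λ x → f x Fin.≟ y)
... | yes hit = hit
... | no miss = contradiction (injective⇒≤ {f = f'} f'-injective) (<-irrefl refl)
  where
  y≢f : ∀ x → y ≢ f x
  y≢f x e = miss (x , sym e)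
  f' : Fin (suc n) → Fin n
  f' x = Fin.punchOut (y≢f x)
  f'-injective : ∀ {a b} → f' a ≡ f' b → a ≡ b
  f'-injective {a} {b} e = f-injective (punchOut-injective (y≢f a) (y≢f b) e)

injective⇒permutation : (f : Fin n → Fin n) → (∀ {x y} → f x ≡ f y → x ≡ y) →
                        Σ (Permutation′ n) λ π → ∀ x → π ⟨$⟩ʳ x ≡ f x
injective⇒permutation {n} f f-injective =
  permutation f (proj₁ ∘ surjective) (proj₂ ∘ surjective) (λ x → f-injective (proj₂ (surjective (f x)))) , λ _ → refl
  where
  surjective : ∀ y → Σ (Fin n) λ x → f x ≡ y
  surjective = injective⇒surjective f f-injective

module _ {ℓ} {P : Pred (Fin n) ℓ} (P? : Decidable P) where

  select : Subset n
  select = tabulate (λ x → if does (P? x) then inside else outside)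

  private
    selected : ∀ {x} → P x → (if does (P? x) then inside else outside) ≡ inside
    selected {x} p with P? x
    ... | yes _ = refl
    ... | no ¬p = contradiction p ¬p

    rejected : ∀ {x} → (if does (P? x) then inside else outside) ≡ inside → P x
    rejected {x} e with P? x
    ... | yes p = p
    ... | no _  with () ← e

  ∈-select⁺ : ∀ {x} → P x → x ∈ select
  ∈-select⁺ {x} p = lookup⇒[]= x select (trans (lookup∘tabulate _ x) (selected p))

  ∈-select⁻ : ∀ {x} → x ∈ select → P x
  ∈-select⁻ {x} x∈ = rejected (trans (sym (lookup∘tabulate _ x)) ([]=⇒lookup x∈))

module _ {n ℓ} {R : Rel (Fin n) ℓ} (R-sto : IsStrictTotalOrder _≡_ R) where
  open IsStrictTotalOrder R-sto using (compare; irrefl) renaming (trans to R-trans; _<?_ to R?)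

  private
    below : Fin n → Subset n
    below j = select (λ i → R? i j)

    rank : Fin n → ℕ
    rank j = ∣ below j ∣

    ∉-below : ∀ j → ¬ (j ∈ below j)
    ∉-below j j∈ = irrefl refl (∈-select⁻ (λ i → R? i j) j∈)

    rank<n : ∀ j → rank j < n
    rank<n j = subst (rank j <_) (∣⊤∣≡n n) (p⊂q⇒∣p∣<∣q∣ (⊆⊤ , j , ∈⊤ , ∉-below j))

    rank-strict : ∀ {j j'} → R j j' → rank j < rank j'
    rank-strict {j} {j'} Rjj' = p⊂q⇒∣p∣<∣q∣ (below-mono , j , ∈-select⁺ (λ i → R? i j') Rjj' , ∉-below j)
      where
      below-mono : ∀ {x} → x ∈ below j → x ∈ below j'
      below-mono x∈ = ∈-select⁺ (λ i → R? i j') (R-trans (∈-select⁻ (λ i → R? i j) x∈) Rjj')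

    rankFin : Fin n → Fin n
    rankFin j = fromℕ< (rank<n j)

    toℕ-rankFin : ∀ j → toℕ (rankFin j) ≡ rank j
    toℕ-rankFin j = toℕ-fromℕ< (rank<n j)

    rank-injective : ∀ {j j'} → rank j ≡ rank j' → j ≡ j'
    rank-injective {j} {j'} e with compare j j'
    ... | tri< Rjj' _ _ = contradiction e (<⇒≢ (rank-strict Rjj'))
    ... | tri≈ _ j≡j' _ = j≡j'
    ... | tri> _ _ Rj'j = contradiction (sym e) (<⇒≢ (rank-strict Rj'j))

    rankFin-injective : ∀ {j j'} → rankFin j ≡ rankFin j' → j ≡ j'
    rankFin-injective {j} {j'} e = rank-injective (trans (sym (toℕ-rankFin j)) (trans (cong toℕ e) (toℕ-rankFin j')))

    ranking : Σ (Permutation′ n) λ π → ∀ x → π ⟨$⟩ʳ x ≡ rankFin x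
    ranking = injective⇒permutation rankFin rankFin-injective

  sortingPermutation : Σ (Permutation′ n) (_Sorts R)
  sortingPermutation = proj₁ ranking , λ j j' → mk⇔ (to j j') (from j j')
    where
    π : Permutation′ n
    π = proj₁ ranking
    toℕ-π : ∀ j → toℕ (π ⟨$⟩ʳ j) ≡ rank j
    toℕ-π j = trans (cong toℕ (proj₂ ranking j)) (toℕ-rankFin j)
    to : ∀ j j' → R j j' → π ⟨$⟩ʳ j <ᶠ π ⟨$⟩ʳ j'
    to j j' Rjj' = subst₂ _<_ (sym (toℕ-π j)) (sym (toℕ-π j')) (rank-strict Rjj')
    from : ∀ j j' → π ⟨$⟩ʳ j <ᶠ π ⟨$⟩ʳ j' → R j j'
    from j j' πj<πj' with compare j j'
    ... | tri< Rjj' _ _ = Rjj'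
    ... | tri≈ _ refl _ = contradiction πj<πj' (<-irrefl refl)
    ... | tri> _ _ Rj'j = contradiction πj<πj' (<-asym (to j' j Rj'j))

sorts-resp : ∀ {ℓ} {R R' : Rel (Fin n) ℓ} {π : Permutation′ n} → (∀ j j' → R j j' ≡ R' j j') → π Sorts R → π Sorts R'
sorts-resp R≡R' sorts j j' = subst (_⇔ _) (R≡R' j j') (sorts j j')

identity-sorts : {π : Permutation′ n} → (∀ j → π ⟨$⟩ʳ j ≡ j) → π Sorts _<ᶠ_
identity-sorts π≈id j j' = mk⇔ (subst₂ _<ᶠ_ (sym (π≈id j)) (sym (π≈id j'))) (subst₂ _<ᶠ_ (π≈id j) (π≈id j'))

⊇<⇒identity-sorts : ∀ {ℓ} {R : Rel (Fin n) ℓ} → IsStrictTotalOrder _≡_ R →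
  (∀ {j j'} → j <ᶠ j' → R j j') → idₚ Sorts R
⊇<⇒identity-sorts {R = R} sto <⇒R j j' = mk⇔ R⇒< <⇒R
  where
  open IsStrictTotalOrder sto using (irrefl; asym)
  R⇒< : R j j' → j <ᶠ j'
  R⇒< Rjj' with <ᶠ-cmp j j'
  ... | tri< j<j' _ _ = j<j'
  ... | tri≈ _ j≡j' _ = contradiction Rjj' (irrefl j≡j')
  ... | tri> _ _ j'<j = contradiction (<⇒R j'<j) (asym Rjj')

-- The statistic λ(g) and compatibility

descentBit : ℕ → ℕ → ℕ → ℕ → ℕ → ℕ
descentBit r c c' s s' = if ⌊ mod0 c r ≟ mod0 c' r ⌋ ∧ ⌊ s' <? s ⌋ then 1 else 0

descentBit-true : ∀ r c c' {s s'} → mod0 c r ≡ mod0 c' r → s' < s → descentBit r c c' s s' ≡ 1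
descentBit-true r c c' {s} {s'} c≡c' s'<s with mod0 c r ≟ mod0 c' r | s' <? s
... | yes _ | yes _    = refl
... | yes _ | no s'≮s = contradiction s'<s s'≮s
... | no c≢c' | _     = contradiction c≡c' c≢c'

descentBit-cases : ∀ r c c' s s' →
  descentBit r c c' s s' ≡ 0 ⊎ (descentBit r c c' s s' ≡ 1 × mod0 c r ≡ mod0 c' r × s' < s)
descentBit-cases r c c' s s' with mod0 c r ≟ mod0 c' r | s' <? s
... | yes c≡c' | yes s'<s = inj₂ (refl , c≡c' , s'<s)
... | yes _    | no _     = inj₁ refl
... | no _     | _        = inj₁ refl

hk-cons : ∀ r b s c s' c' xs → hk r b ((s , c) ∷ (s' , c') ∷ xs) ≡
  (proj₁ (hk r b ((s' , c') ∷ xs)) + descentBit r c c' s s' , proj₂ (hk r b ((s' , c') ∷ xs)) + diffMod r c c')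
hk-cons r b s c s' c' xs with hk r b ((s' , c') ∷ xs)
... | h , k = refl

drop-tabulate : ∀ {A : Set} (f : Fin n → A) (i : Fin n) →
                drop (toℕ i) (List.tabulate f) ≡ f i ∷ drop (suc (toℕ i)) (List.tabulate f)
drop-tabulate f fzero    = refl
drop-tabulate f (fsuc i) = drop-tabulate (λ j → f (fsuc j)) i

drop-tabulate-all : ∀ {A : Set} n (f : Fin n → A) → drop n (List.tabulate f) ≡ []
drop-tabulate-all zero    f = refl
drop-tabulate-all (suc n) f = drop-tabulate-all n (λ j → f (fsuc j))

entry : Mon n → Fin n → ℕ × ℕ
entry g j = toℕ (perm g ⟨$⟩ʳ j) , col g j

entries : Mon n → List (ℕ × ℕ)
entries g = List.tabulate (entry g)

λ-from : ℕ → ℕ × ℕ → ℕ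
λ-from r (h , k) = r * h + k

lamG-unfold : ∀ r b (g : Mon n) i → lamG r b g i ≡ λ-from r (hk r b (drop (toℕ i) (entries g)))
lamG-unfold r b g i with hk r b (drop (toℕ i) (entries g))
... | h , k = refl

λ-increment : ℕ → Mon n → Fin n → Fin n → ℕ
λ-increment r g x y =
  r * descentBit r (col g x) (col g y) (toℕ (perm g ⟨$⟩ʳ x)) (toℕ (perm g ⟨$⟩ʳ y)) + diffMod r (col g x) (col g y)

lamG-step : ∀ r b (g : Mon n) {x y} → toℕ y ≡ suc (toℕ x) → lamG r b g x ≡ lamG r b g y + λ-increment r g x y
lamG-step r b g {x} {y} y≡1+x = begin
  lamG r b g x                                           ≡⟨ lamG-unfold r b g x ⟩
  λ-from r (hk r b (drop (toℕ x) (entries g)))           ≡⟨ cong (λ-from r ∘ hk r b) drop-x ⟩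
  λ-from r (hk r b (entry g x ∷ entry g y ∷ rest))       ≡⟨ cong (λ-from r) (hk-cons r b _ _ _ _ rest) ⟩
  r * (proj₁ hʸ + I) + (proj₂ hʸ + D)                    ≡⟨ regroup r (proj₁ hʸ) I (proj₂ hʸ) D ⟩
  λ-from r hʸ + (r * I + D)                              ≡⟨ cong (_+ (r * I + D)) (sym lamG-y) ⟩
  lamG r b g y + λ-increment r g x y                     ∎
  where
  open ≡-Reasoning
  rest : List (ℕ × ℕ)
  rest = drop (suc (toℕ y)) (entries g)
  drop-y : drop (toℕ y) (entries g) ≡ entry g y ∷ rest
  drop-y = drop-tabulate (entry g) y
  drop-x : drop (toℕ x) (entries g) ≡ entry g x ∷ entry g y ∷ rest
  drop-x = trans (drop-tabulate (entry g) x) (cong (entry g x ∷_) (trans (cong (λ t → drop t (entries g)) (sym y≡1+x)) drop-y))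
  hʸ : ℕ × ℕ
  hʸ = hk r b (entry g y ∷ rest)
  I D : ℕ
  I = descentBit r (col g x) (col g y) (toℕ (perm g ⟨$⟩ʳ x)) (toℕ (perm g ⟨$⟩ʳ y))
  D = diffMod r (col g x) (col g y)
  lamG-y : lamG r b g y ≡ λ-from r hʸ
  lamG-y = trans (lamG-unfold r b g y) (cong (λ-from r ∘ hk r b) drop-y)
  regroup : ∀ r h I k D → r * (h + I) + (k + D) ≡ (r * h + k) + (r * I + D)
  regroup = solve 5 (λ r h I k D → r :* (h :+ I) :+ (k :+ D) := (r :* h :+ k) :+ (r :* I :+ D)) refl

lamG-last : ∀ r b (g : Mon (suc n)) x → toℕ x ≡ n → lamG r b g x ≡ mod0 (col g x) (div0 r b)
lamG-last {n} r b g x x≡n = begin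
  lamG r b g x                                   ≡⟨ lamG-unfold r b g x ⟩
  λ-from r (hk r b (drop (toℕ x) (entries g)))   ≡⟨ cong (λ-from r ∘ hk r b) drop-x ⟩
  r * 0 + mod0 (col g x) (div0 r b)              ≡⟨ cong (_+ mod0 (col g x) (div0 r b)) (*-zeroʳ r) ⟩
  mod0 (col g x) (div0 r b)                      ∎
  where
  open ≡-Reasoning
  drop-x : drop (toℕ x) (entries g) ≡ entry g x ∷ []
  drop-x = trans (drop-tabulate (entry g) x)
    (cong (entry g x ∷_) (trans (cong (λ t → drop (suc t) (entries g)) x≡n) (drop-tabulate-all (suc n) (entry g))))

diffMod-+ : ∀ {r} b e → 0 < r → diffMod r (b + e) b ≡ mod0 e r
diffMod-+ {suc r} b e _ = begin
  (b + e + c) % R              ≡⟨ cong (λ t → (t + e + c) % R) (m≡m%n+[m/n]*n b R) ⟩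
  (m + q * R + e + c) % R      ≡⟨ cong (_% R) (regroup m (q * R) e c) ⟩
  (e + (m + c) + q * R) % R    ≡⟨ [m+kn]%n≡m%n (e + (m + c)) q R ⟩
  (e + (m + c)) % R            ≡⟨ cong (λ t → (e + t) % R) (m+[n∸m]≡n (<⇒≤ (m%n<n b R))) ⟩
  (e + R) % R                  ≡⟨ [m+n]%n≡m%n e R ⟩
  e % R                        ∎
  where
  open ≡-Reasoning
  R m q c : ℕ
  R = suc r
  m = b % R
  q = b / R
  c = R ∸ m
  regroup : ∀ x y e z → x + y + e + z ≡ e + (x + z) + y
  regroup = solve 4 (λ x y e z → x :+ y :+ e :+ z := e :+ (x :+ z) :+ y) refl

diffMod-self : ∀ {r} a → 0 < r → diffMod r a a ≡ 0
diffMod-self {suc r} a r>0 = trans (cong (λ t → diffMod (suc r) t a) (sym (+-identityʳ a))) (diffMod-+ a 0 r>0)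

r*1+e%r≤e : ∀ {r e} → 0 < r → 0 < e → r ∣ e → r * 1 + mod0 e r ≤ e
r*1+e%r≤e {suc r} _ e>0 (divides zero refl) = contradiction e>0 (<-irrefl refl)
r*1+e%r≤e {suc r} _ _   (divides (suc t) refl) = begin
  suc r * 1 + suc t * suc r % suc r  ≡⟨ cong₂ _+_ (*-identityʳ (suc r)) (m*n%n≡0 (suc t) (suc r)) ⟩
  suc r + 0                          ≤⟨ +-monoʳ-≤ (suc r) z≤n ⟩
  suc r + t * suc r                  ∎
  where open ≤-Reasoning

IncrementsBounded : ℕ → Mon n → (Fin n → ℕ) → Set
IncrementsBounded r g μ = ∀ {x y} → toℕ y ≡ suc (toℕ x) → λ-increment r g x y ≤ μ x ∸ μ y

LexDecreasing : Permutation′ n → (Fin n → ℕ) → Set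
LexDecreasing σ μ = ∀ {x y} → x <ᶠ y → μ y < μ x ⊎ (μ x ≡ μ y × σ ⟨$⟩ʳ x <ᶠ σ ⟨$⟩ʳ y)

module _ {r b : ℕ} where

  compatible⇒incrementsBounded : {g : Mon n} {μ : Fin n → ℕ} → Compatible r b g μ → IncrementsBounded r g μ
  compatible⇒incrementsBounded {n} {g = g} {μ} (_ , λ≤μ , gaps , _) {x} {y} y≡1+x = m+n≤o⇒m≤o∸n inc (begin
    inc + μ y                 ≡⟨ cong (inc +_) (sym (m∸n+n≡m (λ≤μ y))) ⟩
    inc + (μ y ∸ L y + L y)   ≤⟨ +-monoʳ-≤ inc (+-monoˡ-≤ (L y) (gaps x y (<⇒≤ (adjacent⇒< y≡1+x)))) ⟩
    inc + (μ x ∸ L x + L y)   ≡⟨ x∙yz≈y∙zx inc (μ x ∸ L x) (L y) ⟩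
    μ x ∸ L x + (L y + inc)   ≡⟨ cong (μ x ∸ L x +_) (sym (lamG-step r b g y≡1+x)) ⟩
    μ x ∸ L x + L x           ≡⟨ m∸n+n≡m (λ≤μ x) ⟩
    μ x                       ∎)
    where
    open ≤-Reasoning
    L : Fin n → ℕ
    L = lamG r b g
    inc : ℕ
    inc = λ-increment r g x y

  -- Equal parts leave no room for the increment, so x is no descent of g; yet equal colours and
  -- σ y < σ x would make it one.
  compatible⇒adjacentTies : {g : Mon n} {μ : Fin n → ℕ} → 0 < r → Compatible r b g μ →
    ∀ {x y} → toℕ y ≡ suc (toℕ x) → μ x ≡ μ y → perm g ⟨$⟩ʳ x <ᶠ perm g ⟨$⟩ʳ y
  compatible⇒adjacentTies {g = g} {μ} r>0 compatible@(_ , _ , _ , _ , m , colours) {x} {y} y≡1+x μx≡μy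
    with <ᶠ-cmp (perm g ⟨$⟩ʳ x) (perm g ⟨$⟩ʳ y)
  ... | tri< σx<σy _ _ = σx<σy
  ... | tri≈ _ σx≡σy _ = contradiction (⟨$⟩ʳ-injective (perm g) σx≡σy) (<⇒≢ (adjacent⇒< y≡1+x) ∘ cong toℕ)
  ... | tri> _ _ σy<σx = contradiction (descentBit-true r (col g x) (col g y) same-colour σy<σx) (subst (_≢ 1) (sym bit≡0) λ ())
    where
    bit : ℕ
    bit = descentBit r (col g x) (col g y) (toℕ (perm g ⟨$⟩ʳ x)) (toℕ (perm g ⟨$⟩ʳ y))
    no-room : λ-increment r g x y ≡ 0
    no-room = n≤0⇒n≡0 (subst (λ-increment r g x y ≤_) gap≡0 (compatible⇒incrementsBounded {g = g} compatible y≡1+x))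
      where
      gap≡0 : μ x ∸ μ y ≡ 0
      gap≡0 = trans (cong (_∸ μ y) μx≡μy) (n∸n≡0 (μ y))
    bit≡0 : bit ≡ 0
    bit≡0 with m*n≡0⇒m≡0∨n≡0 r (m+n≡0⇒m≡0 (r * bit) no-room)
    ... | inj₁ r≡0 = contradiction r≡0 (>⇒≢ r>0)
    ... | inj₂ bit≡0 = bit≡0
    same-colour : mod0 (col g x) r ≡ mod0 (col g y) r
    same-colour = trans (colours x) (trans (cong (λ t → mod0 (t + m * div0 r b) r) μx≡μy) (sym (colours y)))

adjacentTies⇒lexDecreasing : {σ : Permutation′ n} {μ : Fin n → ℕ} → IsPartition μ →
  (∀ {x y} → toℕ y ≡ suc (toℕ x) → μ x ≡ μ y → σ ⟨$⟩ʳ x <ᶠ σ ⟨$⟩ʳ y) → LexDecreasing σ μ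
adjacentTies⇒lexDecreasing {n} {σ} {μ} partition adjacentTies {x} {y} x<y with m≤n⇒m<n∨m≡n (partition x y (<⇒≤ x<y))
... | inj₁ μy<μx = inj₁ μy<μx
... | inj₂ μy≡μx = inj₂ (sym μy≡μx , proj₂ (chain R R-trans R-adjacent x<y) (sym μy≡μx))
  where
  R : Fin n → Fin n → Set
  R a c = μ c ≤ μ a × (μ a ≡ μ c → σ ⟨$⟩ʳ a <ᶠ σ ⟨$⟩ʳ c)
  R-trans : ∀ {a c e} → R a c → R c e → R a e
  R-trans {a} {c} {e} (μc≤μa , tieac) (μe≤μc , tiece) = ≤-trans μe≤μc μc≤μa , λ μa≡μe →
    let μa≡μc = ≤-antisym (subst (_≤ μ c) (sym μa≡μe) μe≤μc) μc≤μa
    in <-trans (tieac μa≡μc) (tiece (trans (sym μa≡μc) μa≡μe))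
  R-adjacent : ∀ {a c} → toℕ c ≡ suc (toℕ a) → R a c
  R-adjacent c≡1+a = partition _ _ (<⇒≤ (adjacent⇒< c≡1+a)) , adjacentTies c≡1+a

compatible⇒lexDecreasing : ∀ {r b} {g : Mon n} {μ : Fin n → ℕ} → 0 < r → Compatible r b g μ → LexDecreasing (perm g) μ
compatible⇒lexDecreasing {r = r} {b} {g} r>0 compatible =
  adjacentTies⇒lexDecreasing {σ = perm g} (proj₁ compatible) (compatible⇒adjacentTies {r = r} {b} {g = g} r>0 compatible)

compatible-colours : ∀ {n r b} {g : Mon n} {μ : Fin n → ℕ} → 0 < r → Compatible r b g μ →
  Σ ℕ λ m → ∀ x → col g x ≋ μ x + m * div0 r b [mod r ]
compatible-colours r>0 (_ , _ , _ , _ , m , colours) = m , λ x → %-≡⇒≋ r>0 (colours x)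

lexDecreasing⇒partition : {σ : Permutation′ n} {μ : Fin n → ℕ} → LexDecreasing σ μ → IsPartition μ
lexDecreasing⇒partition {μ = μ} decreasing x y x≤y with m≤n⇒m<n∨m≡n x≤y
... | inj₂ x≡y = ≤-reflexive (cong μ (toℕ-injective (sym x≡y)))
... | inj₁ x<y with decreasing x<y
...   | inj₁ μy<μx = <⇒≤ μy<μx
...   | inj₂ (μx≡μy , _) = ≤-reflexive (sym μx≡μy)

lexDecreasing-reflects : {σ : Permutation′ n} {μ : Fin n → ℕ} → LexDecreasing σ μ →
  ∀ {x y} → μ y < μ x ⊎ (μ x ≡ μ y × σ ⟨$⟩ʳ x <ᶠ σ ⟨$⟩ʳ y) → x <ᶠ y
lexDecreasing-reflects {σ = σ} {μ} decreasing {x} {y} before with <ᶠ-cmp x y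
... | tri< x<y _ _ = x<y
... | tri≈ _ refl _ = contradiction before λ { (inj₁ μx<μx) → <-irrefl refl μx<μx ; (inj₂ (_ , σx<σx)) → <-irrefl refl σx<σx }
... | tri> _ _ y<x = contradiction (decreasing y<x) λ
  { (inj₁ μx<μy) → [ <-asym μx<μy , (λ (μx≡μy , _) → <-irrefl μx≡μy μx<μy) ]′ before
  ; (inj₂ (μy≡μx , σy<σx)) → [ <-irrefl μy≡μx , (λ (_ , σx<σy) → <-asym σx<σy σy<σx) ]′ before }

lexDecreasing⇒incrementsBounded : ∀ {r} {σ : Permutation′ n} {μ : Fin n → ℕ} → 0 < r →
  LexDecreasing σ μ → IncrementsBounded r [ σ ⨾ μ ] μ
lexDecreasing⇒incrementsBounded {r = r} {σ} {μ} r>0 decreasing {x} {y} y≡1+x =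
  bound (decreasing (adjacent⇒< y≡1+x)) (descentBit-cases r (μ x) (μ y) (toℕ (σ ⟨$⟩ʳ x)) (toℕ (σ ⟨$⟩ʳ y)))
  where
  open ≤-Reasoning
  bit : ℕ
  bit = descentBit r (μ x) (μ y) (toℕ (σ ⟨$⟩ʳ x)) (toℕ (σ ⟨$⟩ʳ y))
  bound : μ y < μ x ⊎ (μ x ≡ μ y × σ ⟨$⟩ʳ x <ᶠ σ ⟨$⟩ʳ y) →
          bit ≡ 0 ⊎ (bit ≡ 1 × mod0 (μ x) r ≡ mod0 (μ y) r × toℕ (σ ⟨$⟩ʳ y) < toℕ (σ ⟨$⟩ʳ x)) →
          r * bit + diffMod r (μ x) (μ y) ≤ μ x ∸ μ y
  bound (inj₂ (_ , σx<σy)) (inj₂ (_ , _ , σy<σx)) = contradiction σx<σy (<-asym σy<σx)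
  bound (inj₂ (μx≡μy , _)) (inj₁ bit≡0) = begin
    r * bit + diffMod r (μ x) (μ y)  ≡⟨ cong₂ (λ b d → r * b + d) bit≡0 diff≡0 ⟩
    r * 0 + 0                        ≡⟨ cong (_+ 0) (*-zeroʳ r) ⟩
    0                                ≤⟨ z≤n ⟩
    μ x ∸ μ y                        ∎
    where
    diff≡0 : diffMod r (μ x) (μ y) ≡ 0
    diff≡0 = trans (cong (λ t → diffMod r t (μ y)) μx≡μy) (diffMod-self (μ y) r>0)
  bound (inj₁ μy<μx) bit-case = positive-gap bit-case
    where
    e : ℕ
    e = μ x ∸ μ y
    μx≡μy+e : μ x ≡ μ y + e
    μx≡μy+e = sym (m+[n∸m]≡n (<⇒≤ μy<μx))
    diff≡ : diffMod r (μ x) (μ y) ≡ mod0 e r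
    diff≡ = trans (cong (λ t → diffMod r t (μ y)) μx≡μy+e) (diffMod-+ (μ y) e r>0)
    r∣e : mod0 (μ x) r ≡ mod0 (μ y) r → r ∣ e
    r∣e same = ∣-resp-≋ (≋-sym e≋0) (r ∣0)
      where
      e≋0 : e ≋ 0 [mod r ]
      e≋0 = +-cancelʳ-≋ (subst (_≋ μ y [mod r ]) (trans μx≡μy+e (+-comm (μ y) e)) (%-≡⇒≋ r>0 same))
    positive-gap : bit ≡ 0 ⊎ (bit ≡ 1 × mod0 (μ x) r ≡ mod0 (μ y) r × toℕ (σ ⟨$⟩ʳ y) < toℕ (σ ⟨$⟩ʳ x)) →
             r * bit + diffMod r (μ x) (μ y) ≤ e
    positive-gap (inj₁ bit≡0) = begin
      r * bit + diffMod r (μ x) (μ y)  ≡⟨ cong₂ (λ b d → r * b + d) bit≡0 diff≡ ⟩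
      r * 0 + mod0 e r                 ≡⟨ cong (_+ mod0 e r) (*-zeroʳ r) ⟩
      mod0 e r                         ≤⟨ mod0≤ e r ⟩
      e                                ∎
    positive-gap (inj₂ (bit≡1 , same , _)) = begin
      r * bit + diffMod r (μ x) (μ y)  ≡⟨ cong₂ (λ b d → r * b + d) bit≡1 diff≡ ⟩
      r * 1 + mod0 e r                 ≤⟨ r*1+e%r≤e r>0 (m<n⇒0<n∸m μy<μx) (r∣e same) ⟩
      e                                ∎

incrementsBounded⇒compatible : ∀ {r b} {σ : Permutation′ n} {μ : Fin n → ℕ} →
  IsPartition μ → IncrementsBounded r [ σ ⨾ μ ] μ → Compatible r b [ σ ⨾ μ ] μ
incrementsBounded⇒compatible {zero} partition _ = partition , (λ ()) , (λ ()) , (λ _ → refl) , 0 , (λ ())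
incrementsBounded⇒compatible {suc n} {r} {b} {σ} {μ} partition bounded =
  partition , λ≤μ , antitone⇒partition (λ x → μ x ∸ L x) gap-step , (λ _ → refl) , 0 ,
  (λ i → cong (λ t → mod0 t r) (sym (+-identityʳ (μ i))))
  where
  open ≤-Reasoning
  g : Mon (suc n)
  g = [ σ ⨾ μ ]
  L : Fin (suc n) → ℕ
  L = lamG r b g
  room : ∀ {x y} → toℕ y ≡ suc (toℕ x) → μ y + λ-increment r g x y ≤ μ x
  room {x} {y} y≡1+x = begin
    μ y + λ-increment r g x y  ≤⟨ +-monoʳ-≤ (μ y) (bounded y≡1+x) ⟩
    μ y + (μ x ∸ μ y)          ≡⟨ m+[n∸m]≡n (partition x y (<⇒≤ (adjacent⇒< y≡1+x))) ⟩
    μ x                        ∎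
  λ≤μ : ∀ x → L x ≤ μ x
  λ≤μ = >-weakInduction (λ x → L x ≤ μ x) last step
    where
    last : L (fromℕ n) ≤ μ (fromℕ n)
    last = subst (_≤ μ (fromℕ n)) (sym (lamG-last r b g (fromℕ n) (toℕ-fromℕ n))) (mod0≤ (μ (fromℕ n)) (div0 r b))
    step : ∀ i → L (fsuc i) ≤ μ (fsuc i) → L (inject₁ i) ≤ μ (inject₁ i)
    step i ih = begin
      L (inject₁ i)                                          ≡⟨ lamG-step r b g (toℕ-adjacent i) ⟩
      L (fsuc i) + λ-increment r g (inject₁ i) (fsuc i)      ≤⟨ +-monoˡ-≤ _ ih ⟩
      μ (fsuc i) + λ-increment r g (inject₁ i) (fsuc i)      ≤⟨ room (toℕ-adjacent i) ⟩
      μ (inject₁ i)                                          ∎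
  gap-step : ∀ {x y} → toℕ y ≡ suc (toℕ x) → μ y ∸ L y ≤ μ x ∸ L x
  gap-step {x} {y} y≡1+x = begin
    μ y ∸ L y        ≤⟨ ∸-monoˡ-≤ (L y) (m+n≤o⇒m≤o∸n (μ y) (room y≡1+x)) ⟩
    μ x ∸ inc ∸ L y  ≡⟨ ∸-+-assoc (μ x) inc (L y) ⟩
    μ x ∸ (inc + L y) ≡⟨ cong (μ x ∸_) (trans (+-comm inc (L y)) (sym (lamG-step r b g y≡1+x))) ⟩
    μ x ∸ L x        ∎
    where
    inc : ℕ
    inc = λ-increment r g x y

lexDecreasing⇒compatible : ∀ {r b} {σ : Permutation′ n} {μ : Fin n → ℕ} → 0 < r →
  LexDecreasing σ μ → Compatible r b [ σ ⨾ μ ] μ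
lexDecreasing⇒compatible {r = r} {b} {σ} r>0 decreasing = incrementsBounded⇒compatible {r = r} {b} {σ}
  (lexDecreasing⇒partition {σ = σ} decreasing) (lexDecreasing⇒incrementsBounded {r = r} {σ = σ} r>0 decreasing)

-- Prefix products and the lexicographic column order

prefixPerm : (Fin k → Mon n) → Fin (suc k) → Permutation′ n
prefixPerm g fzero = idₚ
prefixPerm {suc k} g (fsuc i) = perm (g fzero) ∘ₚ prefixPerm (g ∘ fsuc) i

τ≈prefixPerm : (g : Fin k → Mon n) (i : Fin k) → τ g i ≈ prefixPerm g (inject₁ i)
τ≈prefixPerm g fzero    j = refl
τ≈prefixPerm g (fsuc i) j = τ≈prefixPerm (g ∘ fsuc) i (perm (g fzero) ⟨$⟩ʳ j)

prefixPerm-step : (g : Fin k → Mon n) (i : Fin k) → ∀ j →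
                  prefixPerm g (fsuc i) ⟨$⟩ʳ j ≡ perm (g i) ⟨$⟩ʳ (prefixPerm g (inject₁ i) ⟨$⟩ʳ j)
prefixPerm-step g fzero    j = refl
prefixPerm-step g (fsuc i) j = prefixPerm-step (g ∘ fsuc) i (perm (g fzero) ⟨$⟩ʳ j)

prefixPerm-last : ∀ k (g : Fin k → Mon n) → prefixPerm g (fromℕ k) ≈ perm (prodₘ k g)
prefixPerm-last zero    g j = refl
prefixPerm-last (suc k) g j = prefixPerm-last k (g ∘ fsuc) (perm (g fzero) ⟨$⟩ʳ j)

col-prodₘ : ∀ k (g : Fin k → Mon n) j → col (prodₘ k g) j ≡ Σ[ k ] (λ i → col (g i) (prefixPerm g (inject₁ i) ⟨$⟩ʳ j))
col-prodₘ zero    g j = refl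
col-prodₘ (suc k) g j = cong (col (g fzero) j +_) (col-prodₘ k (g ∘ fsuc) (perm (g fzero) ⟨$⟩ʳ j))

Φ≡prefixPerm : (g : Fin k → Mon n) (lam : Matrix k n) → ∀ i j → Φ g lam i j ≡ lam i (prefixPerm g (inject₁ i) ⟨$⟩ʳ j)
Φ≡prefixPerm g lam i j = cong (lam i) (τ≈prefixPerm g i j)

RowLex : (Fin n → ℕ) → Rel (Fin n) 0ℓ → Rel (Fin n) 0ℓ
RowLex a R' j j' = a j' < a j ⊎ (a j ≡ a j' × R' j j')

-- Columns ordered by rows i, i+1, … of A (larger entries first), finally by index.
Lex : Matrix k n → Fin (suc k) → Rel (Fin n) 0ℓ
Lex {zero}  A fzero    = _<ᶠ_
Lex {suc k} A fzero    = RowLex (A fzero) (Lex (A ∘ fsuc) fzero)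
Lex {suc k} A (fsuc i) = Lex (A ∘ fsuc) i

Lex-step : (A : Matrix k n) (i : Fin k) → ∀ j j' → Lex A (inject₁ i) j j' ≡ RowLex (A i) (Lex A (fsuc i)) j j'
Lex-step A fzero    j j' = refl
Lex-step A (fsuc i) j j' = Lex-step (A ∘ fsuc) i j j'

Lex-last : (A : Matrix k n) → ∀ j j' → Lex A (fromℕ k) j j' ≡ (j <ᶠ j')
Lex-last {zero}  A j j' = refl
Lex-last {suc k} A j j' = Lex-last (A ∘ fsuc) j j'

Lex-cong : {A B : Matrix k n} → (∀ i j → A i j ≡ B i j) → ∀ i j j' → Lex A i j j' ≡ Lex B i j j'
Lex-cong {zero}  A≡B fzero    j j' = refl
Lex-cong {suc k} A≡B fzero    j j' =
  cong₂ _⊎_ (cong₂ _<_ (A≡B fzero j') (A≡B fzero j))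
            (cong₂ _×_ (cong₂ _≡_ (A≡B fzero j) (A≡B fzero j')) (Lex-cong (A≡B ∘ fsuc) fzero j j'))
Lex-cong {suc k} A≡B (fsuc i) j j' = Lex-cong (A≡B ∘ fsuc) i j j'

Lex-trans : (A : Matrix k n) → ∀ i → Transitive (Lex A i)
Lex-trans {zero}  A fzero = <ᶠ-trans
Lex-trans {suc k} A fzero {a} {b} {c} (inj₁ ba) (inj₁ cb)       = inj₁ (<-trans cb ba)
Lex-trans {suc k} A fzero {a} {b} {c} (inj₁ ba) (inj₂ (b≡c , _)) = inj₁ (subst (_< A fzero a) b≡c ba)
Lex-trans {suc k} A fzero {a} {b} {c} (inj₂ (a≡b , _)) (inj₁ cb) = inj₁ (subst (A fzero c <_) (sym a≡b) cb)
Lex-trans {suc k} A fzero (inj₂ (a≡b , ab)) (inj₂ (b≡c , bc)) = inj₂ (trans a≡b b≡c , Lex-trans (A ∘ fsuc) fzero ab bc)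
Lex-trans {suc k} A (fsuc i) = Lex-trans (A ∘ fsuc) i

Lex-compare : (A : Matrix k n) → ∀ i → Trichotomous _≡_ (Lex A i)
Lex-compare {zero}  A fzero = <ᶠ-cmp
Lex-compare {suc k} A (fsuc i) = Lex-compare (A ∘ fsuc) i
Lex-compare {suc k} A fzero j j' with <-cmp (A fzero j') (A fzero j) | Lex-compare (A ∘ fsuc) fzero j j'
... | tri< a'<a _ _ | _ = tri< (inj₁ a'<a) (λ { refl → <-irrefl refl a'<a })
  λ { (inj₁ a<a') → <-asym a'<a a<a' ; (inj₂ (a'≡a , _)) → <-irrefl a'≡a a'<a }
... | tri> _ _ a<a' | _ = tri> (λ { (inj₁ a'<a) → <-asym a'<a a<a' ; (inj₂ (a≡a' , _)) → <-irrefl a≡a' a<a' })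
  (λ { refl → <-irrefl refl a<a' }) (inj₁ a<a')
... | tri≈ a'≮a a'≡a a≮a' | tri< l j≢j' ¬l' = tri< (inj₂ (sym a'≡a , l)) j≢j'
  λ { (inj₁ a<a') → a≮a' a<a' ; (inj₂ (_ , l')) → ¬l' l' }
... | tri≈ a'≮a a'≡a a≮a' | tri≈ ¬l j≡j' ¬l' = tri≈
  (λ { (inj₁ a'<a) → a'≮a a'<a ; (inj₂ (_ , l)) → ¬l l }) j≡j'
  (λ { (inj₁ a<a') → a≮a' a<a' ; (inj₂ (_ , l')) → ¬l' l' })
... | tri≈ a'≮a a'≡a a≮a' | tri> ¬l j≢j' l' = tri>
  (λ { (inj₁ a'<a) → a'≮a a'<a ; (inj₂ (_ , l)) → ¬l l }) j≢j' (inj₂ (a'≡a , l'))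

Lex-isStrictTotalOrder : (A : Matrix k n) → ∀ i → IsStrictTotalOrder _≡_ (Lex A i)
Lex-isStrictTotalOrder A i = record
  { isStrictPartialOrder = record
    { isEquivalence = isEquivalence
    ; irrefl        = tri⇒irr (Lex-compare A i)
    ; trans         = Lex-trans A i
    ; <-resp-≈      = resp₂ (Lex A i)
    }
  ; compare = Lex-compare A i
  }

lexDecreasing⇒sorts : {σ T T' : Permutation′ n} {μ a : Fin n → ℕ} {R' : Rel (Fin n) 0ℓ} →
  LexDecreasing σ μ → (∀ j → a j ≡ μ (T ⟨$⟩ʳ j)) → (∀ j → T' ⟨$⟩ʳ j ≡ σ ⟨$⟩ʳ (T ⟨$⟩ʳ j)) →
  T' Sorts R' → T Sorts RowLex a R'
lexDecreasing⇒sorts {σ = σ} {T} {T'} {μ} {a} {R'} decreasing a≡μT T'≡σT T'-sorts j j' = mk⇔ to from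
  where
  to : RowLex a R' j j' → T ⟨$⟩ʳ j <ᶠ T ⟨$⟩ʳ j'
  to (inj₁ a'<a) = lexDecreasing-reflects {σ = σ} decreasing (inj₁ (subst₂ _<_ (a≡μT j') (a≡μT j) a'<a))
  to (inj₂ (a≡a' , R'jj')) = lexDecreasing-reflects {σ = σ} decreasing (inj₂
    (trans (sym (a≡μT j)) (trans a≡a' (a≡μT j')) ,
     subst₂ _<ᶠ_ (T'≡σT j) (T'≡σT j') (Equivalence.to (T'-sorts j j') R'jj')))
  from : T ⟨$⟩ʳ j <ᶠ T ⟨$⟩ʳ j' → RowLex a R' j j'
  from Tj<Tj' with decreasing Tj<Tj'
  ... | inj₁ μ'<μ = inj₁ (subst₂ _<_ (sym (a≡μT j')) (sym (a≡μT j)) μ'<μ)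
  ... | inj₂ (μ≡μ' , σ<σ') = inj₂ (trans (a≡μT j) (trans μ≡μ' (sym (a≡μT j'))) ,
    Equivalence.from (T'-sorts j j') (subst₂ _<ᶠ_ (sym (T'≡σT j)) (sym (T'≡σT j')) σ<σ'))

sorts⇒lexDecreasing : {T T' : Permutation′ n} {a : Fin n → ℕ} {R' : Rel (Fin n) 0ℓ} →
  T Sorts RowLex a R' → T' Sorts R' → LexDecreasing (flip T ∘ₚ T') (λ x → a (T ⟨$⟩ˡ x))
sorts⇒lexDecreasing {T = T} T-sorts T'-sorts {x} {y} x<y
  with Equivalence.from (T-sorts _ _) (subst₂ _<ᶠ_ (sym (inverseʳ T)) (sym (inverseʳ T)) x<y)
... | inj₁ a'<a = inj₁ a'<a
... | inj₂ (a≡a' , R'xy) = inj₂ (a≡a' , Equivalence.to (T'-sorts _ _) R'xy)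

Lex-skip : (A : Matrix k n) (i : Fin (suc k)) {j j' : Fin n} →
  (∀ (h : Fin k) → toℕ h < toℕ i → A h j ≡ A h j') → Lex A fzero j j' → Lex A i j j'
Lex-skip {zero}  A fzero    _    lex = lex
Lex-skip {suc k} A fzero    _    lex = lex
Lex-skip {suc k} A (fsuc i) same (inj₁ a'<a) = contradiction a'<a (<-irrefl (sym (same fzero (s≤s z≤n))))
Lex-skip {suc k} A (fsuc i) same (inj₂ (_ , lex)) = Lex-skip (A ∘ fsuc) i (λ h h<i → same (fsuc h) (s≤s h<i)) lex

identity-sortsLex⇒kpartite : {A : Matrix k n} → idₚ Sorts Lex A fzero → IsKPartite A
identity-sortsLex⇒kpartite {A = A} sorts i j j' j'≡1+j same =
  row-i (subst id (Lex-step A i j j') (Lex-skip A (inject₁ i) same-below (Equivalence.from (sorts j j') (adjacent⇒< j'≡1+j))))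
  where
  same-below : ∀ h → toℕ h < toℕ (inject₁ i) → A h j ≡ A h j'
  same-below h h<i = same h (subst (toℕ h <_) (toℕ-inject₁ i) h<i)
  row-i : RowLex (A i) (Lex A (fsuc i)) j j' → A i j' ≤ A i j
  row-i (inj₁ a'<a)      = <⇒≤ a'<a
  row-i (inj₂ (a≡a' , _)) = ≤-reflexive (sym a≡a')

kpartite⇒adjacentLex : {A : Matrix k n} → IsKPartite A → ∀ {j j'} → toℕ j' ≡ suc (toℕ j) → Lex A fzero j j'
kpartite⇒adjacentLex {k} {A = A} kpartite {j} {j'} j'≡1+j = >-weakInduction Q last step fzero (λ _ ())
  where
  Q : Fin (suc k) → Set
  Q i = (∀ (h : Fin k) → toℕ h < toℕ i → A h j ≡ A h j') → Lex A i j j'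
  last : Q (fromℕ k)
  last _ = subst id (sym (Lex-last A j j')) (adjacent⇒< j'≡1+j)
  step : ∀ i → Q (fsuc i) → Q (inject₁ i)
  step i ih same = subst id (sym (Lex-step A i j j')) (row-i (m≤n⇒m<n∨m≡n (kpartite i j j' j'≡1+j same-below)))
    where
    same-below : ∀ h → toℕ h < toℕ i → A h j ≡ A h j'
    same-below h h<i = same h (subst (toℕ h <_) (sym (toℕ-inject₁ i)) h<i)
    row-i : A i j' < A i j ⊎ A i j' ≡ A i j → RowLex (A i) (Lex A (fsuc i)) j j'
    row-i (inj₁ a'<a) = inj₁ a'<a
    row-i (inj₂ a'≡a) = inj₂ (sym a'≡a , ih same-through-i)
      where
      same-through-i : ∀ h → toℕ h < suc (toℕ i) → A h j ≡ A h j'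
      same-through-i h h≤i with m≤n⇒m<n∨m≡n (s≤s⁻¹ h≤i)
      ... | inj₁ h<i = same-below h h<i
      ... | inj₂ h≡i = subst (λ t → A t j ≡ A t j') (sym (toℕ-injective h≡i)) (sym a'≡a)

kpartite⇒identity-sortsLex : {A : Matrix k n} → IsKPartite A → idₚ Sorts Lex A fzero
kpartite⇒identity-sortsLex {A = A} kpartite = ⊇<⇒identity-sorts (Lex-isStrictTotalOrder A fzero)
  (chain (Lex A fzero) (Lex-trans A fzero) (kpartite⇒adjacentLex kpartite))

-- The bijection

div0-exact : ∀ {p r} → 0 < p → p ∣ r → r ≡ p * div0 r p
div0-exact {suc p} _ p∣r = sym (m*[n/m]≡n p∣r)

quotient-divides : ∀ {p r m} → 0 < p → p ∣ r → r ∣ p * m → div0 r p ∣ m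
quotient-divides {suc p} {r} {m} p>0 p∣r r∣pm = *-cancelˡ-∣ (suc p) (subst (_∣ suc p * m) (div0-exact p>0 p∣r) r∣pm)

q∣n*[r/p] : ∀ {p q r n} → 0 < p → p ∣ r → p * q ∣ r * n → q ∣ n * div0 r p
q∣n*[r/p] {suc p} {q} {r} {n} p>0 p∣r pq∣rn = *-cancelˡ-∣ (suc p) (subst (suc p * q ∣_) rn≡ pq∣rn)
  where
  rn≡ : r * n ≡ suc p * (n * div0 r (suc p))
  rn≡ = trans (cong (_* n) (div0-exact p>0 p∣r)) (swap (suc p) (div0 r (suc p)) n)
    where
    swap : ∀ p d n → p * d * n ≡ p * (n * d)
    swap = solve 3 (λ p d n → p :* d :* n := p :* (n :* d)) refl

-- p copies of the shift m'·(r/p) make the full turn m'·r.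
shifts-absorbed : ∀ {p d} → 0 < p → ∀ a m m' → a + m' * d + (m + (p ∸ 1) * m') * d ≋ a + m * d [mod p * d ]
shifts-absorbed {suc p} {d} _ a m m' = 0 , m' , regroup a m m' p d
  where
  regroup : ∀ a m m' p d → a + m' * d + (m + p * m') * d + 0 * (suc p * d) ≡ a + m * d + m' * (suc p * d)
  regroup = solve 5 (λ a m m' p d → a :+ m' :* d :+ (m :+ p :* m') :* d :+ con 0 :* ((con 1 :+ p) :* d)
                                  := a :+ m :* d :+ m' :* ((con 1 :+ p) :* d)) refl

module Bijection {r p q n k : ℕ} (r>0 : 0 < r) (p>0 : 0 < p) (p∣r : p ∣ r) (q∣r : q ∣ r) (pq∣rn : p * q ∣ r * n) where

  private
    d : ℕ
    d = div0 r p

    r≡p*d : r ≡ p * d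
    r≡p*d = div0-exact p>0 p∣r

    p*[x*d]≡x*r : ∀ x → p * (x * d) ≡ x * r
    p*[x*d]≡x*r x = trans (solve 3 (λ p x d → p :* (x :* d) := x :* (p :* d)) refl p x d) (cong (x *_) (sym r≡p*d))

  module Domain {g : Fin k → Mon n} {lam : Matrix k n} (dom : InDom r p q n k g lam) where

    T : Fin (suc k) → Permutation′ n
    T = prefixPerm g

    compatible : ∀ i → Compatible r p (g i) (lam i)
    compatible = proj₂ (proj₂ dom)

    private
      colours : ∀ i → Σ ℕ λ m → ∀ x → col (g i) x ≋ lam i x + m * d [mod r ]
      colours i = compatible-colours {b = p} {g i} {lam i} r>0 (compatible i)

    shift : Fin k → ℕ
    shift i = proj₁ (colours i)

    colour≋ : ∀ i x → col (g i) x ≋ lam i x + shift i * d [mod r ]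
    colour≋ i = proj₂ (colours i)

    product-shift : ℕ
    product-shift = proj₁ (proj₂ (proj₁ (proj₂ dom)))

    -- The columns of Φ are read off in the order τ_i; the product being 1 pins τ_{k+1} = id.
    T-sorts : ∀ i → T i Sorts Lex (Φ g lam) i
    T-sorts = >-weakInduction (λ i → T i Sorts Lex (Φ g lam) i) last step
      where
      last : T (fromℕ k) Sorts Lex (Φ g lam) (fromℕ k)
      last = sorts-resp {π = T (fromℕ k)} (λ j j' → sym (Lex-last (Φ g lam) j j'))
        (identity-sorts {π = T (fromℕ k)} (λ j → trans (prefixPerm-last k g j) (proj₁ (proj₁ (proj₂ dom)) j)))
      step : ∀ i → T (fsuc i) Sorts Lex (Φ g lam) (fsuc i) → T (inject₁ i) Sorts Lex (Φ g lam) (inject₁ i)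
      step i ih = sorts-resp {π = T (inject₁ i)} (λ j j' → sym (Lex-step (Φ g lam) i j j'))
        (lexDecreasing⇒sorts {σ = perm (g i)} {T (inject₁ i)} {T (fsuc i)}
          (compatible⇒lexDecreasing {b = p} {g i} r>0 (compatible i)) (Φ≡prefixPerm g lam i) (prefixPerm-step g i) ih)

    row-recovered : ∀ i x → Φ g lam i (T (inject₁ i) ⟨$⟩ˡ x) ≡ lam i x
    row-recovered i x = trans (Φ≡prefixPerm g lam i _) (cong (lam i) (inverseʳ (T (inject₁ i))))

    perm-recovered : ∀ i x → T (fsuc i) ⟨$⟩ʳ (T (inject₁ i) ⟨$⟩ˡ x) ≡ perm (g i) ⟨$⟩ʳ x
    perm-recovered i x = trans (prefixPerm-step g i _) (cong (perm (g i) ⟨$⟩ʳ_) (inverseʳ (T (inject₁ i))))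

    row-divisible : ∀ i → q ∣ Σ[ n ] (lam i)
    row-divisible i = ∣m+n∣m⇒∣n (subst (q ∣_) (+-comm (Σ[ n ] (lam i)) _) q∣sum) q∣shifts
      where
      shifts≡ : Σ[ n ] (λ _ → shift i * d) ≡ n * d * shift i
      shifts≡ = trans (Σ-const n (shift i * d)) (solve 3 (λ n s d → n :* (s :* d) := n :* d :* s) refl n (shift i) d)
      q∣shifts : q ∣ Σ[ n ] (λ _ → shift i * d)
      q∣shifts = subst (q ∣_) (sym shifts≡) (∣m⇒∣m*n (shift i) (q∣n*[r/p] p>0 p∣r pq∣rn))
      q∣sum : q ∣ Σ[ n ] (lam i) + Σ[ n ] (λ _ → shift i * d)
      q∣sum = ∣-resp-≋ (≋-weaken q∣r (subst (λ t → Σ[ n ] (col (g i)) ≋ t [mod r ]) (Σ-distrib-+ (lam i) (λ _ → shift i * d))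
                                         (Σ-cong-≋ (colour≋ i))))
                       (proj₁ dom i)

    column : Fin n → ℕ
    column j = Σ[ k ] (λ i → Φ g lam i j)

    column≋ : ∀ j → column j + Σ[ k ] shift * d ≋ product-shift * d [mod r ]
    column≋ j = ≋-trans (≋-sym product≋sum) (%-≡⇒≋ r>0 (proj₂ (proj₂ (proj₁ (proj₂ dom))) j))
      where
      open ≡-Reasoning
      sum≡ : Σ[ k ] (λ i → lam i (T (inject₁ i) ⟨$⟩ʳ j) + shift i * d) ≡ column j + Σ[ k ] shift * d
      sum≡ = begin
        Σ[ k ] (λ i → lam i (T (inject₁ i) ⟨$⟩ʳ j) + shift i * d)
          ≡⟨ Σ-distrib-+ (λ i → lam i (T (inject₁ i) ⟨$⟩ʳ j)) (λ i → shift i * d) ⟩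
        Σ[ k ] (λ i → lam i (T (inject₁ i) ⟨$⟩ʳ j)) + Σ[ k ] (λ i → shift i * d)
          ≡⟨ cong₂ _+_ (Σ-cong (λ i → sym (Φ≡prefixPerm g lam i j))) (Σ-distrib-*ʳ shift d) ⟩
        column j + Σ[ k ] shift * d                                            ∎
      product≋sum : col (prodₘ k g) j ≋ column j + Σ[ k ] shift * d [mod r ]
      product≋sum = subst₂ (λ a b → a ≋ b [mod r ]) (sym (col-prodₘ k g j)) sum≡
                           (Σ-cong-≋ (λ i → colour≋ i (T (inject₁ i) ⟨$⟩ʳ j)))

  Φ-into : {g : Fin k → Mon n} {lam : Matrix k n} → InDom r p q n k g lam → InB r p q (Φ g lam)
  Φ-into {g} {lam} dom = identity-sortsLex⇒kpartite (T-sorts fzero) , rows , columns-congruent , columns-divisible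
    where
    open Domain dom
    rows : ∀ i → q ∣ Σ[ n ] (Φ g lam i)
    rows i = subst (q ∣_) (sym (trans (Σ-cong (Φ≡prefixPerm g lam i)) (Σ-permute (lam i) (T (inject₁ i))))) (row-divisible i)
    columns-congruent : ∀ j j' → column j ≡[mod r ] column j'
    columns-congruent j j' = ≋⇒%-≡ r>0 (+-cancelʳ-≋ (≋-trans (column≋ j) (≋-sym (column≋ j'))))
    columns-divisible : ∀ j → r ∣ p * column j
    columns-divisible j = ∣-resp-≋ (≋-sym p*column≋0) (r ∣0)
      where
      p*column≋0 : p * column j ≋ 0 [mod r ]
      p*column≋0 = ≋-trans (≋-trans add-turns (*-congˡ-≋ p (column≋ j)))
                           (subst (_≋ 0 [mod r ]) (sym (p*[x*d]≡x*r product-shift)) (*-multiple-≋ product-shift))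
        where
        add-turns : p * column j ≋ p * (column j + Σ[ k ] shift * d) [mod r ]
        add-turns = subst₂ (λ a b → a ≋ b [mod r ])
          (+-identityʳ (p * column j))
          (sym (trans (*-distribˡ-+ p (column j) _) (cong (p * column j +_) (p*[x*d]≡x*r (Σ[ k ] shift)))))
          (+-cong-≋ ≋-refl (≋-sym (*-multiple-≋ (Σ[ k ] shift))))

  Φ-injective : {g g' : Fin k → Mon n} {lam lam' : Matrix k n} →
    InDom r p q n k g lam → InDom r p q n k g' lam' → (∀ i j → Φ g lam i j ≡ Φ g' lam' i j) →
    (∀ i → EqG r p (g i) (g' i)) × (∀ i j → lam i j ≡ lam' i j)
  Φ-injective {g} {g'} {lam} {lam'} dom dom' Φ≡Φ' = same-elements , same-rows
    where
    module D = Domain dom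
    module D' = Domain dom'
    open ≡-Reasoning

    same-prefixes : ∀ i → D.T i ≈ D'.T i
    same-prefixes i = sorts-unique (D.T i) (D'.T i) (D.T-sorts i)
      (sorts-resp {π = D'.T i} (λ j j' → sym (Lex-cong Φ≡Φ' i j j')) (D'.T-sorts i))

    same-rows : ∀ i x → lam i x ≡ lam' i x
    same-rows i x = begin
      lam i x                              ≡⟨ sym (D.row-recovered i x) ⟩
      Φ g lam i y                          ≡⟨ Φ≡Φ' i y ⟩
      Φ g' lam' i y                        ≡⟨ Φ≡prefixPerm g' lam' i y ⟩
      lam' i (D'.T (inject₁ i) ⟨$⟩ʳ y)     ≡⟨ cong (lam' i) (sym (same-prefixes (inject₁ i) y)) ⟩
      lam' i (D.T (inject₁ i) ⟨$⟩ʳ y)      ≡⟨ cong (lam' i) (inverseʳ (D.T (inject₁ i))) ⟩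
      lam' i x                             ∎
      where
      y : Fin n
      y = D.T (inject₁ i) ⟨$⟩ˡ x

    same-perms : ∀ i x → perm (g i) ⟨$⟩ʳ x ≡ perm (g' i) ⟨$⟩ʳ x
    same-perms i x = begin
      perm (g i) ⟨$⟩ʳ x                             ≡⟨ sym (D.perm-recovered i x) ⟩
      D.T (fsuc i) ⟨$⟩ʳ y                           ≡⟨ same-prefixes (fsuc i) y ⟩
      D'.T (fsuc i) ⟨$⟩ʳ y                          ≡⟨ prefixPerm-step g' i y ⟩
      perm (g' i) ⟨$⟩ʳ (D'.T (inject₁ i) ⟨$⟩ʳ y)    ≡⟨ cong (perm (g' i) ⟨$⟩ʳ_) (sym (same-prefixes (inject₁ i) y)) ⟩
      perm (g' i) ⟨$⟩ʳ (D.T (inject₁ i) ⟨$⟩ʳ y)     ≡⟨ cong (perm (g' i) ⟨$⟩ʳ_) (inverseʳ (D.T (inject₁ i))) ⟩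
      perm (g' i) ⟨$⟩ʳ x                            ∎
      where
      y : Fin n
      y = D.T (inject₁ i) ⟨$⟩ˡ x

    same-elements : ∀ i → EqG r p (g i) (g' i)
    same-elements i = same-perms i , m + (p ∸ 1) * m' , λ x → ≋⇒%-≡ r>0 (colours x)
      where
      m m' : ℕ
      m = D.shift i
      m' = D'.shift i
      colours : ∀ x → col (g i) x ≋ col (g' i) x + (m + (p ∸ 1) * m') * d [mod r ]
      colours x = ≋-trans (D.colour≋ i x) (≋-sym (≋-trans (+-cong-≋ colour' ≋-refl) absorbed))
        where
        colour' : col (g' i) x ≋ lam i x + m' * d [mod r ]
        colour' = subst (λ t → col (g' i) x ≋ t + m' * d [mod r ]) (sym (same-rows i x)) (D'.colour≋ i x)
        absorbed : lam i x + m' * d + (m + (p ∸ 1) * m') * d ≋ lam i x + m * d [mod r ]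
        absorbed = subst (λ t → lam i x + m' * d + (m + (p ∸ 1) * m') * d ≋ lam i x + m * d [mod t ]) (sym r≡p*d)
                          (shifts-absorbed p>0 (lam i x) m m')

  Φ-onto : 0 < n → (A : Matrix k n) → InB r p q A →
    Σ (Fin k → Mon n) λ g → Σ (Matrix k n) λ lam → InDom r p q n k g lam × (∀ i j → Φ g lam i j ≡ A i j)
  Φ-onto n>0 A (kpartite , rows , columns-congruent , columns-divisible) = g , lam , (inG , product-one , compatible) , Φ≡A
    where
    P : Fin (suc k) → Permutation′ n
    P i = proj₁ (sortingPermutation (Lex-isStrictTotalOrder A i))

    P-sorts : ∀ i → P i Sorts Lex A i
    P-sorts i = proj₂ (sortingPermutation (Lex-isStrictTotalOrder A i))

    lam : Matrix k n
    lam i x = A i (P (inject₁ i) ⟨$⟩ˡ x)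

    g : Fin k → Mon n
    g i = [ flip (P (inject₁ i)) ∘ₚ P (fsuc i) ⨾ lam i ]

    P-first : ∀ j → P fzero ⟨$⟩ʳ j ≡ j
    P-first j = sym (sorts-unique idₚ (P fzero) (kpartite⇒identity-sortsLex kpartite) (P-sorts fzero) j)

    P-last : ∀ j → P (fromℕ k) ⟨$⟩ʳ j ≡ j
    P-last j = sym (sorts-unique idₚ (P (fromℕ k))
      (sorts-resp {π = idₚ} (λ j j' → sym (Lex-last A j j')) (identity-sorts {π = idₚ} (λ _ → refl))) (P-sorts (fromℕ k)) j)

    prefix≈P : ∀ i → prefixPerm g i ≈ P i
    prefix≈P = <-weakInduction (λ i → prefixPerm g i ≈ P i) (λ j → sym (P-first j)) step
      where
      step : ∀ i → prefixPerm g (inject₁ i) ≈ P (inject₁ i) → prefixPerm g (fsuc i) ≈ P (fsuc i)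
      step i ih j = trans (prefixPerm-step g i j) (trans
        (cong (λ t → P (fsuc i) ⟨$⟩ʳ (P (inject₁ i) ⟨$⟩ˡ t)) (ih j)) (cong (P (fsuc i) ⟨$⟩ʳ_) (inverseˡ (P (inject₁ i)))))

    Φ≡A : ∀ i j → Φ g lam i j ≡ A i j
    Φ≡A i j = trans (Φ≡prefixPerm g lam i j)
      (trans (cong (lam i) (prefix≈P (inject₁ i) j)) (cong (A i) (inverseˡ (P (inject₁ i)))))

    inG : ∀ i → InG r q n (g i)
    inG i = subst (q ∣_) (sym (Σ-permute (A i) (flip (P (inject₁ i))))) (rows i)

    compatible : ∀ i → Compatible r p (g i) (lam i)
    compatible i = lexDecreasing⇒compatible {b = p} {flip (P (inject₁ i)) ∘ₚ P (fsuc i)} r>0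
      (sorts⇒lexDecreasing {T = P (inject₁ i)} {P (fsuc i)} {A i}
        (sorts-resp {π = P (inject₁ i)} (Lex-step A i) (P-sorts (inject₁ i))) (P-sorts (fsuc i)))

    column : Fin n → ℕ
    column j = Σ[ k ] (λ i → A i j)

    j₀ : Fin n
    j₀ = fromℕ< n>0

    d∣column : d ∣ column j₀
    d∣column = quotient-divides p>0 p∣r (columns-divisible j₀)

    product-one : EqG r p (prodₘ k g) oneₘ
    product-one =
      (λ j → trans (sym (prefixPerm-last k g j)) (trans (prefix≈P (fromℕ k) j) (P-last j))) , _∣_.quotient d∣column ,
      λ j → trans (cong (λ t → mod0 t r) (product-column j))
                  (trans (columns-congruent j j₀) (cong (λ t → mod0 t r) (_∣_.equality d∣column)))
      where
      product-column : ∀ j → col (prodₘ k g) j ≡ column j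
      product-column j = trans (col-prodₘ k g j) (Σ-cong (λ i → trans (sym (Φ≡prefixPerm g lam i j)) (Φ≡A i j)))

theorem8p4 : (r p q n k : ℕ) → 0 < r → 0 < p → 0 < q → 0 < n → 0 < k →
    p ∣ r → q ∣ r → (p * q) ∣ (r * n) →
    ((g : Fin k → Mon n) (lam : Matrix k n) → InDom r p q n k g lam → InB r p q (Φ g lam)) ×
    ((g g' : Fin k → Mon n) (lam lam' : Matrix k n) → InDom r p q n k g lam → InDom r p q n k g' lam' →
      (∀ i j → Φ g lam i j ≡ Φ g' lam' i j) →
      (∀ i → EqG r p (g i) (g' i)) × (∀ i j → lam i j ≡ lam' i j)) ×
    ((A : Matrix k n) → InB r p q A →
      Σ (Fin k → Mon n) λ g → Σ (Matrix k n) λ lam → InDom r p q n k g lam × (∀ i j → Φ g lam i j ≡ A i j))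
theorem8p4 r p q n k r>0 p>0 _ n>0 _ p∣r q∣r pq∣rn =
  (λ _ _ → Φ-into) , (λ _ _ _ _ → Φ-injective) , Φ-onto n>0
  where open Bijection {k = k} r>0 p>0 p∣r q∣r pq∣rn
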